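{- Let $n\ge 2$ and let $H\subseteq\mathbb{R}^n$ be a good halfspace. For any $I\subseteq[n]$ with $|I|\ge 2$ and any $b\in\{0,1\}$, there is a partial restriction $\rho\in\{0,1,*\}^n$ with $\mathrm{fix}(\rho)=I$ such that $\bigoplus_{i\in I}\rho(x_i)=b$ and $H\restriction\rho\subseteq\mathbb{R}^{\mathrm{free}(\rho)}$ is good.
   Context: A halfspace is the set of points satisfying a linear inequality. For $\rho\in\{0,1,*\}^n$, $\mathrm{free}(\rho):=\rho^{ -1}(*)$, $\mathrm{fix}(\rho):=[n]\setminus\mathrm{free}(\rho)$, and $\rho(x_i)$ is the value $\rho$ assigns to coordinate $i$. The restriction $H\restriction\rho:=\{x\in\mathbb{R}^{\mathrm{free}(\rho)}:\exists\alpha\in H,\ \alpha_{\mathrm{fix}(\rho)}=\rho_{\mathrm{fix}(\rho)},\ \alpha_{\mathrm{free}(\rho)}=x\}$. A halfspace in $\mathbb{R}^k$ is good if it contains the all-$\tfrac12$ vector. -}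

module Defs where

open import Level using (Level; _⊔_; Lift) renaming (suc to lsuc)
open import Algebra.Bundles using (CommutativeRing)
open import Relation.Binary.Core using (Rel)
open import Relation.Binary.Structures using (IsTotalOrder)
open import Relation.Nullary using (¬_)
open import Relation.Binary.PropositionalEquality using (_≡_)
open import Data.Product using (Σ; ∃; _×_; _,_)
open import Data.Nat using (ℕ; zero; suc)
open import Data.Fin using (Fin; zero; suc)
open import Data.Bool using (Bool; true; false; _xor_; if_then_else_)
open import Data.Maybe using (Maybe; just; nothing; is-just)
open import Data.Vec using (tabulate)
open import Data.Fin.Subset using (Subset; _∈_)

-- Ordered fields (the paper works over ℝ; the statement is made for an
-- arbitrary ordered field, which includes ℝ).

record OrderedField (c ℓ₁ ℓ₂ : Level) : Set (lsuc (c ⊔ ℓ₁ ⊔ ℓ₂)) where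
  field
    commutativeRing : CommutativeRing c ℓ₁
  open CommutativeRing commutativeRing public
  field
    _≤_          : Rel Carrier ℓ₂
    isTotalOrder : IsTotalOrder _≈_ _≤_
    0≉1          : ¬ (0# ≈ 1#)
    inverse      : ∀ x → ¬ (x ≈ 0#) → ∃ λ y → (x * y) ≈ 1#
    +-mono-≤     : ∀ {x y} z → x ≤ y → (x + z) ≤ (y + z)
    *-nonneg     : ∀ {x y} → 0# ≤ x → 0# ≤ y → 0# ≤ (x * y)

  _<_ : Rel Carrier (ℓ₁ ⊔ ℓ₂)
  x < y = (x ≤ y) × ¬ (x ≈ y)

module _ {c ℓ₁ ℓ₂} (F : OrderedField c ℓ₁ ℓ₂) where
  open OrderedField F using (Carrier; _≈_; _≤_; _<_; _+_; _*_; 0#; 1#)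

  sumF : ∀ {n} → (Fin n → Carrier) → Carrier
  sumF {zero}  f = 0#
  sumF {suc n} f = f zero + sumF (λ i → f (suc i))

  dot : ∀ {n} → (Fin n → Carrier) → (Fin n → Carrier) → Carrier
  dot a x = sumF (λ i → a i * x i)

  -- A halfspace in F^n: the solution set of a linear inequality
  --   c ≤ a · x   (strict = false)   or   c < a · x   (strict = true).
  -- (Inequalities of the form a·x ≤ c / a·x < c are covered by negating a, c.)
  record Halfspace (n : ℕ) : Set c where
    constructor halfspace
    field
      coeff     : Fin n → Carrier
      threshold : Carrier
      strict    : Bool

  _∈H_ : ∀ {n} → (Fin n → Carrier) → Halfspace n → Set (ℓ₁ ⊔ ℓ₂)
  x ∈H halfspace a t false = Lift ℓ₁ (t ≤ dot a x)
  x ∈H halfspace a t true  = t < dot a x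

  -- A set S ⊆ F^I (I any index type) is good if it contains the all-½
  -- vector, i.e. the constant vector with value h where h + h = 1.
  Good : ∀ {a ℓ} {Ix : Set a} → ((Ix → Carrier) → Set ℓ) → Set (c ⊔ ℓ₁ ⊔ ℓ)
  Good S = Σ Carrier λ h → ((h + h) ≈ 1#) × S (λ _ → h)

  bitF : Bool → Carrier
  bitF false = 0#
  bitF true  = 1#

-- Partial restrictions ρ ∈ {0,1,*}^n : nothing = *, just b = b.

Restriction : ℕ → Set
Restriction n = Fin n → Maybe Bool

fix : ∀ {n} → Restriction n → Subset n
fix ρ = tabulate (λ i → is-just (ρ i))

Free : ∀ {n} → Restriction n → Set
Free {n} ρ = Σ (Fin n) (λ i → ρ i ≡ nothing)

-- the bit ρ(x_i) (only meaningful for fixed i)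
val : Maybe Bool → Bool
val (just b) = b
val nothing  = false

parityOn : ∀ {n} → Subset n → Restriction n → Bool
parityOn {zero}  _ ρ = false
parityOn {suc n} (true  Data.Vec.∷ I) ρ = val (ρ zero) xor parityOn I (λ i → ρ (suc i))
parityOn {suc n} (false Data.Vec.∷ I) ρ = parityOn I (λ i → ρ (suc i))

module _ {c ℓ₁ ℓ₂} (F : OrderedField c ℓ₁ ℓ₂) where
  open OrderedField F using (Carrier; _≈_; _≤_; _<_; _+_; _*_; 0#; 1#)

  restrict : ∀ {n} → Halfspace F n → (ρ : Restriction n) → (Free ρ → Carrier) → Set (c ⊔ ℓ₁ ⊔ ℓ₂)
  restrict {n} H ρ x =
    Σ (Fin n → Carrier) λ α →
      _∈H_ F α H
      × (∀ i b → ρ i ≡ just b → α i ≈ bitF F b)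
      × (∀ (j : Free ρ) → α (Data.Product.proj₁ j) ≈ x j)

{-# OPTIONS --safe #-}
-- Put ½ on every coordinate outside I and a bit on every coordinate of I.
-- Each coordinate i ∈ I alone can be set so that aᵢ·bit ≥ aᵢ·½ (take the
-- larger of 0 and aᵢ), which keeps a·x ≥ a·½ and hence keeps the point in H.
-- To prescribe the parity, two coordinates i, j ∈ I are set jointly: among
-- the two bit pairs of the required parity, the better one gives at least the
-- average aᵢ/2 + aⱼ/2, since (1,1),(0,0) average to it and so do (1,0),(0,1).
module Submission where

open import Defs
open import Data.Nat as ℕ using (ℕ; s≤s)
open import Data.Bool using (Bool; true; false; _xor_; if_then_else_)
open import Data.Bool.Properties using (xor-assoc; xor-same; xor-identityʳ)
open import Data.Product using (∃; ∃₂; _×_; _,_; proj₁)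
open import Data.Sum using (inj₁; inj₂)
open import Data.Maybe using (just; nothing; is-just; maybe)
open import Data.Fin using (Fin; zero; suc)
open import Data.Fin.Subset using (Subset; ∣_∣)
open import Function using (_∘_)
open import Data.Vec using (Vec; []; _∷_; lookup)
open import Data.Vec.Properties using (tabulate-cong; tabulate∘lookup)
open import Level using (lift)
open import Relation.Binary.Bundles using (Poset)
open import Relation.Binary.Structures using (IsTotalOrder)
open import Relation.Binary.PropositionalEquality as ≡ using (_≡_)
import Algebra.Properties.CommutativeSemigroup as CommutativeSemigroupProperties
import Relation.Binary.Reasoning.PartialOrder as PartialOrderReasoning

xor-cancelʳ : ∀ e f b p → e xor f ≡ b xor p → e xor (f xor p) ≡ b
xor-cancelʳ e f b p e⊕f≡b⊕p = begin
  e xor (f xor p)   ≡⟨ ≡.sym (xor-assoc e f p) ⟩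
  (e xor f) xor p   ≡⟨ ≡.cong (_xor p) e⊕f≡b⊕p ⟩
  (b xor p) xor p   ≡⟨ xor-assoc b p p ⟩
  b xor (p xor p)   ≡⟨ ≡.cong (b xor_) (xor-same p) ⟩
  b xor false       ≡⟨ xor-identityʳ b ⟩
  b                 ∎
  where open ≡.≡-Reasoning

restriction : ∀ {n} → Subset n → Vec Bool n → Restriction n
restriction I β i = if lookup I i then just (lookup β i) else nothing

fix-restriction : ∀ {n} (I : Subset n) β → fix (restriction I β) ≡ I
fix-restriction I β = ≡.trans (tabulate-cong is-just-if) (tabulate∘lookup I)
  where
  is-just-if : ∀ i → is-just (restriction I β i) ≡ lookup I i
  is-just-if i with lookup I i
  ... | true  = ≡.refl
  ... | false = ≡.refl

module OrderedFieldProperties {c ℓ₁ ℓ₂} (F : OrderedField c ℓ₁ ℓ₂) where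
  open OrderedField F hiding (zero) renaming (+-mono-≤ to +-monoˡ-≤)
  open IsTotalOrder isTotalOrder using (total; antisym)
    renaming (refl to ≤-refl; trans to ≤-trans)
  open CommutativeSemigroupProperties +-commutativeSemigroup
    using (interchange; x∙yz≈y∙xz)

  poset : Poset c ℓ₁ ℓ₂
  poset = record { isPartialOrder = IsTotalOrder.isPartialOrder isTotalOrder }

  open PartialOrderReasoning poset

  +-monoʳ-≤ : ∀ {x y} z → x ≤ y → (z + x) ≤ (z + y)
  +-monoʳ-≤ {x} {y} z x≤y = begin
    z + x   ≈⟨ +-comm z x ⟩
    x + z   ≤⟨ +-monoˡ-≤ z x≤y ⟩
    y + z   ≈⟨ +-comm y z ⟩
    z + y   ∎

  +-mono-≤ : ∀ {x y u v} → x ≤ y → u ≤ v → (x + u) ≤ (y + v)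
  +-mono-≤ {x} {y} {u} {v} x≤y u≤v = begin
    x + u   ≤⟨ +-monoˡ-≤ u x≤y ⟩
    y + u   ≤⟨ +-monoʳ-≤ y u≤v ⟩
    y + v   ∎

  x≤x+y : ∀ {x y} → 0# ≤ y → x ≤ (x + y)
  x≤x+y {x} {y} 0≤y = begin
    x        ≈⟨ +-identityʳ x ⟨
    x + 0#   ≤⟨ +-monoʳ-≤ x 0≤y ⟩
    x + y    ∎

  ∈H-mono : ∀ {n} {x y : Fin n → Carrier} (H : Halfspace F n) →
            dot F (Halfspace.coeff H) x ≤ dot F (Halfspace.coeff H) y →
            _∈H_ F x H → _∈H_ F y H
  ∈H-mono (halfspace a t false) ax≤ay (lift t≤ax) = lift (≤-trans t≤ax ax≤ay)
  ∈H-mono (halfspace a t true) ax≤ay (t≤ax , t≉ax) =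
    ≤-trans t≤ax ax≤ay ,
    λ t≈ay → t≉ax (antisym t≤ax (begin dot F a _ ≤⟨ ax≤ay ⟩ _ ≈⟨ t≈ay ⟨ t ∎))

  module Half (½ : Carrier) (½+½≈1 : (½ + ½) ≈ 1#) where

    ½s : ∀ {n} → Fin n → Carrier
    ½s _ = ½

    *-1≈*-½+*-½ : ∀ a → (a * 1#) ≈ ((a * ½) + (a * ½))
    *-1≈*-½+*-½ a = trans (*-congˡ (sym ½+½≈1)) (distribˡ a ½ ½)

    *-½≤*-bit : ∀ a → ∃ λ e → (a * ½) ≤ (a * bitF F e)
    *-½≤*-bit a with total 0# (a * ½)
    ... | inj₁ 0≤a½ = true , (begin
      a * ½               ≤⟨ x≤x+y 0≤a½ ⟩
      a * ½ + a * ½       ≈⟨ *-1≈*-½+*-½ a ⟨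
      a * 1#              ∎)
    ... | inj₂ a½≤0 = false , (begin
      a * ½    ≤⟨ a½≤0 ⟩
      0#       ≈⟨ zeroʳ a ⟨
      a * 0#   ∎)

    *-½≤*-bitPair : ∀ c d q → ∃₂ λ e f → (e xor f ≡ q) ×
                    ((c * ½) + (d * ½)) ≤ ((c * bitF F e) + (d * bitF F f))
    *-½≤*-bitPair c d false with total 0# ((c * ½) + (d * ½))
    ... | inj₁ 0≤avg = true , true , ≡.refl , (begin
      c * ½ + d * ½                       ≤⟨ x≤x+y 0≤avg ⟩
      (c * ½ + d * ½) + (c * ½ + d * ½)   ≈⟨ interchange _ _ _ _ ⟩
      (c * ½ + c * ½) + (d * ½ + d * ½)   ≈⟨ +-cong (*-1≈*-½+*-½ c) (*-1≈*-½+*-½ d) ⟨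
      c * 1# + d * 1#                     ∎)
    ... | inj₂ avg≤0 = false , false , ≡.refl , (begin
      c * ½ + d * ½     ≤⟨ avg≤0 ⟩
      0#                ≈⟨ +-identityʳ 0# ⟨
      0# + 0#           ≈⟨ +-cong (zeroʳ c) (zeroʳ d) ⟨
      c * 0# + d * 0#   ∎)
    *-½≤*-bitPair c d true with total (c * ½) (d * ½)
    ... | inj₁ c½≤d½ = false , true , ≡.refl , (begin
      c * ½ + d * ½     ≤⟨ +-monoˡ-≤ (d * ½) c½≤d½ ⟩
      d * ½ + d * ½     ≈⟨ *-1≈*-½+*-½ d ⟨
      d * 1#            ≈⟨ +-identityˡ _ ⟨
      0# + d * 1#       ≈⟨ +-congʳ (zeroʳ c) ⟨
      c * 0# + d * 1#   ∎)
    ... | inj₂ d½≤c½ = true , false , ≡.refl , (begin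
      c * ½ + d * ½     ≤⟨ +-monoʳ-≤ (c * ½) d½≤c½ ⟩
      c * ½ + c * ½     ≈⟨ *-1≈*-½+*-½ c ⟨
      c * 1#            ≈⟨ +-identityʳ _ ⟨
      c * 1# + 0#       ≈⟨ +-congˡ (zeroʳ d) ⟨
      c * 1# + d * 0#   ∎)

    complete : ∀ {n} → Restriction n → Fin n → Carrier
    complete ρ i = maybe (bitF F) ½ (ρ i)

    complete∈H⇒restrict-good : ∀ {n} (H : Halfspace F n) ρ →
                               _∈H_ F (complete ρ) H → Good F (restrict F H ρ)
    complete∈H⇒restrict-good H ρ ρ½∈H =
      ½ , ½+½≈1 , complete ρ , ρ½∈H , complete-fixed , complete-free
      where
      complete-fixed : ∀ i b → ρ i ≡ just b → complete ρ i ≈ bitF F b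
      complete-fixed i b ρi≡b rewrite ρi≡b = refl

      complete-free : ∀ (j : Free ρ) → complete ρ (proj₁ j) ≈ ½
      complete-free (i , ρi≡*) rewrite ρi≡* = refl

    point : ∀ {n} → Subset n → Vec Bool n → Fin n → Carrier
    point I β = complete (restriction I β)

    dot-½≤dot-point : ∀ {n} (I : Subset n) a →
                      ∃ λ β → dot F a ½s ≤ dot F a (point I β)
    dot-½≤dot-point [] a = [] , ≤-refl
    dot-½≤dot-point (true ∷ I) a
      with *-½≤*-bit (a zero) | dot-½≤dot-point I (a ∘ suc)
    ... | e , a₀½≤a₀e | β , q = e ∷ β , +-mono-≤ a₀½≤a₀e q
    dot-½≤dot-point (false ∷ I) a with dot-½≤dot-point I (a ∘ suc)
    ... | β , q = false ∷ β , +-monoʳ-≤ (a zero * ½) q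

    -- c is the coefficient of one further coordinate, whose bit e is paired
    -- with a coordinate of I to meet the parity.
    dot-½≤dot-point-withParity₁ :
      ∀ {n} (I : Subset n) a c b → 1 ℕ.≤ ∣ I ∣ →
      ∃₂ λ e β → (e xor parityOn I (restriction I β) ≡ b) ×
        ((c * ½) + dot F a ½s) ≤ ((c * bitF F e) + dot F a (point I β))
    dot-½≤dot-point-withParity₁ (false ∷ I) a c b 1≤∣I∣
      with dot-½≤dot-point-withParity₁ I (a ∘ suc) c b 1≤∣I∣
    ... | e , β , parity≡b , q = e , false ∷ β , parity≡b , (begin
      c * ½ + (a zero * ½ + dot F (a ∘ suc) ½s)
        ≈⟨ x∙yz≈y∙xz _ _ _ ⟩
      a zero * ½ + (c * ½ + dot F (a ∘ suc) ½s)
        ≤⟨ +-monoʳ-≤ (a zero * ½) q ⟩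
      a zero * ½ + (c * bitF F e + dot F (a ∘ suc) (point I β))
        ≈⟨ x∙yz≈y∙xz _ _ _ ⟩
      c * bitF F e + (a zero * ½ + dot F (a ∘ suc) (point I β))   ∎)
    dot-½≤dot-point-withParity₁ (true ∷ I) a c b _
      with dot-½≤dot-point I (a ∘ suc)
    ... | β , q with *-½≤*-bitPair c (a zero) (b xor parityOn I (restriction I β))
    ... | e , f , e⊕f≡b⊕p , r = e , f ∷ β , xor-cancelʳ e f b _ e⊕f≡b⊕p , (begin
      c * ½ + (a zero * ½ + dot F (a ∘ suc) ½s)
        ≈⟨ +-assoc _ _ _ ⟨
      (c * ½ + a zero * ½) + dot F (a ∘ suc) ½s
        ≤⟨ +-mono-≤ r q ⟩
      (c * bitF F e + a zero * bitF F f) + dot F (a ∘ suc) (point I β)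
        ≈⟨ +-assoc _ _ _ ⟩
      c * bitF F e + (a zero * bitF F f + dot F (a ∘ suc) (point I β))   ∎)

    dot-½≤dot-point-withParity₂ :
      ∀ {n} (I : Subset n) a b → 2 ℕ.≤ ∣ I ∣ →
      ∃ λ β → (parityOn I (restriction I β) ≡ b) × dot F a ½s ≤ dot F a (point I β)
    dot-½≤dot-point-withParity₂ (false ∷ I) a b 2≤∣I∣
      with dot-½≤dot-point-withParity₂ I (a ∘ suc) b 2≤∣I∣
    ... | β , parity≡b , q = false ∷ β , parity≡b , +-monoʳ-≤ (a zero * ½) q
    dot-½≤dot-point-withParity₂ (true ∷ I) a b (s≤s 1≤∣I∣)
      with dot-½≤dot-point-withParity₁ I (a ∘ suc) (a zero) b 1≤∣I∣
    ... | e , β , parity≡b , q = e ∷ β , parity≡b , q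

open import Data.Nat using (_≤_)

lemma5p4 : ∀ {c ℓ₁ ℓ₂} (F : OrderedField c ℓ₁ ℓ₂) (n : ℕ) → 2 ≤ n
           → (H : Halfspace F n) → Good F (λ x → _∈H_ F x H)
           → (I : Subset n) → 2 ≤ ∣ I ∣ → (b : Bool)
           → ∃ λ (ρ : Restriction n) →
               (fix ρ ≡ I) × (parityOn I ρ ≡ b) × Good F (restrict F H ρ)
lemma5p4 F n _ H (½ , ½+½≈1 , ½∈H) I 2≤∣I∣ b =
  let β , parity≡b , a½≤aα = dot-½≤dot-point-withParity₂ I (Halfspace.coeff H) b 2≤∣I∣
      ρ = restriction I β
  in ρ , fix-restriction I β , parity≡b ,
     complete∈H⇒restrict-good H ρ (∈H-mono H a½≤aα ½∈H)
  where
  open OrderedFieldProperties F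
  open Half ½ ½+½≈1
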